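{- For every $n\geq 3$, let $G_n$ be the spider graph obtained from the star $K_{1,n}$ by subdividing each of its edges once. Then $$D(G_n[K_2])=\left\lceil \frac{1+\sqrt{1+8\sqrt{n}}}{2}\right\rceil.$$
   Context: All graphs are finite and simple. For a graph $X$, a vertex labeling $\phi:V(X)\to\{1,\dots,r\}$ is $r$-distinguishing if the only automorphism of $X$ preserving all vertex labels is the identity; the distinguishing number $D(X)$ is the least such $r$. The lexicographic product $G[H]$ has vertex set $V(G)\times V(H)$, with $(a,x)$ adjacent to $(b,y)$ iff $ab\in E(G)$, or $a=b$ and $xy\in E(H)$. -}

module Defs where

open import Level using (0ℓ)
open import Data.Nat using (ℕ; _*_; _∸_; _≥_; _<_; _≤_)
open import Data.Fin using (Fin)
open import Data.Product using (_×_; Σ; ∃; _,_)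
open import Data.Sum using (_⊎_)
open import Relation.Binary.PropositionalEquality using (_≡_; _≢_)
open import Relation.Nullary using (¬_)
open import Function.Bundles using (_↔_; Inverse; _⇔_)

record Graph : Set₁ where
  field
    V : Set
    E : V → V → Set
open Graph public

record Aut (X : Graph) : Set where
  field
    perm     : V X ↔ V X
    preserve : ∀ x y → E X x y ⇔ E X (Inverse.to perm x) (Inverse.to perm y)
open Aut public

Distinguishing : (X : Graph) (r : ℕ) → (V X → Fin r) → Set
Distinguishing X r φ =
  (σ : Aut X) → (∀ v → φ (Inverse.to (perm σ) v) ≡ φ v) → ∀ v → Inverse.to (perm σ) v ≡ v

HasDistLabeling : Graph → ℕ → Set
HasDistLabeling X r = Σ (V X → Fin r) (Distinguishing X r)

DistNumberIs : Graph → ℕ → Set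
DistNumberIs X d = HasDistLabeling X d × (∀ r → r < d → ¬ HasDistLabeling X r)

Lex : Graph → Graph → Graph
Lex G H = record
  { V = V G × V H
  ; E = λ { (a , x) (b , y) → E G a b ⊎ (a ≡ b × E H x y) } }

K2 : Graph
K2 = record { V = Fin 2 ; E = λ x y → x ≢ y }

data SpV (n : ℕ) : Set where
  centre : SpV n
  mid    : Fin n → SpV n
  leaf   : Fin n → SpV n

data SpE {n : ℕ} : SpV n → SpV n → Set where
  c-m : ∀ i → SpE centre (mid i)
  m-c : ∀ i → SpE (mid i) centre
  m-l : ∀ i → SpE (mid i) (leaf i)
  l-m : ∀ i → SpE (leaf i) (mid i)

Spider : ℕ → Graph
Spider n = record { V = SpV n ; E = SpE }

-- d = ⌈(1 + √(1 + 8√n))/2⌉, rendered without reals: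
-- for integer d ≥ 1,  d ≥ (1+√(1+8√n))/2  ⇔  (d(d-1))² ≥ 4n.
-- So the ceiling is the least d with (d(d-1))² ≥ 4n (d = 0 never qualifies for n ≥ 1).
CeilCond : ℕ → ℕ → Set
CeilCond n d = (d * (d ∸ 1)) * (d * (d ∸ 1)) ≥ 4 * n

IsCeilFormula : ℕ → ℕ → Set
IsCeilFormula n d = CeilCond n d × (∀ e → e < d → ¬ CeilCond n e)

-- The two copies (v , 0) and (v , 1) of a vertex of G[K₂] are twins, so a distinguishing labeling
-- gives them distinct labels, and every leg of the spider carries a pair of 2-subsets of the labels
-- (those of its middle twins and of its leaf twins).  Two legs carrying the same pair can be swapped,
-- together with suitable twin swaps, by a label-preserving automorphism; so the n legs carry distinct
-- pairs and n ≤ C(r,2)², which is the ceiling condition because 2 C(r,2) = r (r - 1).  Conversely,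
-- give the legs distinct pairs and the centre twins two different labels.  The leaf copies are the
-- only simplicial vertices, so every automorphism maps centre, middle and leaf fibres to fibres of the
-- same kind and legs to legs; the labels then force it to fix every leg.

module Submission where

open import Defs
open import Data.Bool using (Bool; true; false)
open import Data.Empty using (⊥-elim; ⊥-elim-irr)
open import Data.Fin using (Fin; suc; _↑ˡ_; _↑ʳ_; join; splitAt; combine; inject≤; _≟_)
open import Data.Fin.Patterns using (0F; 1F)
open import Data.Fin.Permutation using (Permutation′; _⟨$⟩ʳ_; _⟨$⟩ˡ_; inverseˡ; inverseʳ; transpose)
open import Data.Fin.Properties
  using (suc-injective; splitAt-join; splitAt⁻¹-↑ˡ; splitAt⁻¹-↑ʳ; combine-injective; injective⇒≤; inject≤-injective; *↔×)
open import Data.Nat using (ℕ; zero; suc; _+_; _*_; _∸_; _≤_; _<_; _≥_; s≤s)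
open import Data.Nat.Properties using (*-distribˡ-+; *-cancelˡ-≤; *-monoʳ-≤)
open import Data.Nat.Tactic.RingSolver using (solve-∀)
open import Data.Product using (Σ-syntax; ∃; ∃₂; _×_; _,_; proj₁; proj₂; curry)
open import Data.Sum using (_⊎_; inj₁; inj₂; [_,_]′)
open import Data.Sum.Properties using (inj₂-injective)
open import Function using (_∘_; id)
open import Function.Bundles using (_↔_; Inverse; _⇔_; Equivalence; Injection; mk↔ₛ′; mk⇔)
open import Function.Construct.Symmetry using (⇔-sym)
open import Function.Definitions using (Injective)
open import Function.Properties.Inverse using (↔-refl; ↔-sym; Inverse⇒Injection)
open import Relation.Binary.PropositionalEquality
  using (_≡_; _≢_; refl; sym; trans; cong; cong₂; subst; subst₂; module ≡-Reasoning)
open import Relation.Nullary using (¬_; does; yes; no; contradiction)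
open import Relation.Nullary.Decidable using (dec-true)

private variable
  G H X : Graph
  n r : ℕ

PreservesEdges : (X : Graph) → (V X → V X) → Set
PreservesEdges X f = ∀ {x y} → E X x y → E X (f x) (f y)

mkAut : (p : V X ↔ V X) → PreservesEdges X (Inverse.to p) → PreservesEdges X (Inverse.from p) → Aut X
mkAut {X} p to-edge from-edge = record
  { perm     = p
  ; preserve = λ x y → mk⇔ to-edge
      (subst₂ (E X) (Inverse.strictlyInverseʳ p x) (Inverse.strictlyInverseʳ p y) ∘ from-edge)
  }

infixr 5 _⟨$⟩_
_⟨$⟩_ : Aut X → V X → V X
σ ⟨$⟩ v = Inverse.to (perm σ) v

aut-edge : (σ : Aut X) → PreservesEdges X (σ ⟨$⟩_)
aut-edge σ {x} {y} = Equivalence.to (preserve σ x y)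

aut-edge⁻ : (σ : Aut X) {x y : V X} → E X (σ ⟨$⟩ x) (σ ⟨$⟩ y) → E X x y
aut-edge⁻ σ {x} {y} = Equivalence.from (preserve σ x y)

idAut : Aut X
idAut = mkAut ↔-refl id id

infix 8 _⁻¹
_⁻¹ : Aut X → Aut X
_⁻¹ {X} σ = mkAut (↔-sym (perm σ)) from-edge (aut-edge σ)
  where
  from-edge : PreservesEdges X (Inverse.from (perm σ))
  from-edge {x} {y} = aut-edge⁻ σ ∘ subst₂ (E X)
    (sym (Inverse.strictlyInverseˡ (perm σ) x)) (sym (Inverse.strictlyInverseˡ (perm σ) y))

aut-inverseˡ : (σ : Aut X) (v : V X) → σ ⟨$⟩ σ ⁻¹ ⟨$⟩ v ≡ v
aut-inverseˡ σ = Inverse.strictlyInverseˡ (perm σ)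

aut-inverseʳ : (σ : Aut X) (v : V X) → σ ⁻¹ ⟨$⟩ σ ⟨$⟩ v ≡ v
aut-inverseʳ σ = Inverse.strictlyInverseʳ (perm σ)

aut-injective : (σ : Aut X) → Injective _≡_ _≡_ (σ ⟨$⟩_)
aut-injective σ {x} {y} σx≡σy =
  trans (sym (aut-inverseʳ σ x)) (trans (cong (σ ⁻¹ ⟨$⟩_) σx≡σy) (aut-inverseʳ σ y))

Simplicial : (X : Graph) → V X → Set
Simplicial X v = ∀ {y z} → E X v y → E X v z → y ≢ z → E X y z

simplicial-reflect : (σ : Aut X) {v : V X} → Simplicial X (σ ⟨$⟩ v) → Simplicial X v
simplicial-reflect σ simplicial vy vz y≢z =
  aut-edge⁻ σ (simplicial (aut-edge σ vy) (aut-edge σ vz) (y≢z ∘ aut-injective σ))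

simplicial-preserve : (σ : Aut X) {v : V X} → Simplicial X v → Simplicial X (σ ⟨$⟩ v)
simplicial-preserve {X} σ {v} =
  simplicial-reflect (σ ⁻¹) ∘ subst (Simplicial X) (sym (aut-inverseʳ σ v))

lexAut : Aut G → (V G → Aut H) → Aut (Lex G H)
lexAut {G} {H} π τ = mkAut (mk↔ₛ′ to from to∘from from∘to)
  (lexMap-edge (aut-edge π) (aut-edge ∘ τ))
  (lexMap-edge (aut-edge (π ⁻¹)) (λ b → aut-edge (τ (π ⁻¹ ⟨$⟩ b) ⁻¹)))
  where
  lexMap : (V G → V G) → (V G → V H → V H) → V (Lex G H) → V (Lex G H)
  lexMap f g (a , x) = f a , g a x

  lexMap-edge : {f : V G → V G} {g : V G → V H → V H} →
                PreservesEdges G f → (∀ a → PreservesEdges H (g a)) → PreservesEdges (Lex G H) (lexMap f g)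
  lexMap-edge f-edge g-edge {a , x} {b , y} (inj₁ ab)          = inj₁ (f-edge ab)
  lexMap-edge f-edge g-edge {a , x} {b , y} (inj₂ (refl , xy)) = inj₂ (refl , g-edge a xy)

  to from : V (Lex G H) → V (Lex G H)
  to   = lexMap (π ⟨$⟩_) (λ a → τ a ⟨$⟩_)
  from = lexMap (π ⁻¹ ⟨$⟩_) (λ b → τ (π ⁻¹ ⟨$⟩ b) ⁻¹ ⟨$⟩_)

  to∘from : ∀ p → to (from p) ≡ p
  to∘from (b , y) = cong₂ _,_ (aut-inverseˡ π b) (aut-inverseˡ (τ (π ⁻¹ ⟨$⟩ b)) y)

  from∘to : ∀ p → from (to p) ≡ p
  from∘to (a , x) rewrite aut-inverseʳ π a = cong (a ,_) (aut-inverseʳ (τ a) x)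

flip : Bool → Fin 2 → Fin 2
flip false x  = x
flip true  0F = 1F
flip true  1F = 0F

flip-involutive : ∀ b x → flip b (flip b x) ≡ x
flip-involutive false x  = refl
flip-involutive true  0F = refl
flip-involutive true  1F = refl

flip-0F : ∀ {b} → flip b 0F ≡ 0F → b ≡ false
flip-0F {false} _ = refl

flipAut : Bool → Aut K2
flipAut b = mkAut (mk↔ₛ′ (flip b) (flip b) (flip-involutive b) (flip-involutive b)) flip-edge flip-edge
  where
  flip-edge : PreservesEdges K2 (flip b)
  flip-edge {x} {y} x≢y fx≡fy =
    x≢y (trans (sym (flip-involutive b x)) (trans (cong (flip b) fx≡fy) (flip-involutive b y)))

infix 4 _↭₂_
_↭₂_ : {A : Set} → (Fin 2 → A) → (Fin 2 → A) → Set
ℓ ↭₂ ℓ′ = Σ[ b ∈ Bool ] (∀ x → ℓ (flip b x) ≡ ℓ′ x)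

↭₂-refl : {A : Set} {ℓ : Fin 2 → A} → ℓ ↭₂ ℓ
↭₂-refl = false , λ _ → refl

↭₂-sym : {A : Set} {ℓ ℓ′ : Fin 2 → A} → ℓ ↭₂ ℓ′ → ℓ′ ↭₂ ℓ
↭₂-sym {ℓ = ℓ} (b , ℓ∘flip≗ℓ′) = b , λ x → trans (sym (ℓ∘flip≗ℓ′ (flip b x))) (cong ℓ (flip-involutive b x))

pairs : ℕ → ℕ
pairs zero    = zero
pairs (suc r) = r + pairs r

pairIndex : (a b : Fin r) → .(a ≢ b) → Fin (pairs r)

-- A 2-subset of Fin (1 + r) either contains 0 and is determined by its other element,
-- or is a 2-subset of Fin r shifted up by one; hence pairs (1 + r) = r + pairs r.
splitPair : (a b : Fin (suc r)) → .(a ≢ b) → Fin r ⊎ Fin (pairs r)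
splitPair 0F      0F      a≢b = ⊥-elim-irr (a≢b refl)
splitPair 0F      (suc b) _   = inj₁ b
splitPair (suc a) 0F      _   = inj₁ a
splitPair (suc a) (suc b) a≢b = inj₂ (pairIndex a b (a≢b ∘ cong suc))

pairIndex {suc r} a b a≢b = join r (pairs r) (splitPair a b a≢b)

pairIndex-cong : {a b c d : Fin r} .{a≢b : a ≢ b} .{c≢d : c ≢ d} → a ≡ c → b ≡ d →
                 pairIndex a b a≢b ≡ pairIndex c d c≢d
pairIndex-cong refl refl = refl

pairIndex-comm : (a b : Fin r) .{a≢b : a ≢ b} .{b≢a : b ≢ a} → pairIndex a b a≢b ≡ pairIndex b a b≢a
pairIndex-comm {suc r} 0F      0F      {a≢b} = ⊥-elim-irr (a≢b refl)
pairIndex-comm {suc r} 0F      (suc b)       = refl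
pairIndex-comm {suc r} (suc a) 0F            = refl
pairIndex-comm {suc r} (suc a) (suc b)       = cong (λ k → join r (pairs r) (inj₂ k)) (pairIndex-comm a b)

pairIndex-injective : {a b c d : Fin r} .{a≢b : a ≢ b} .{c≢d : c ≢ d} →
                      pairIndex a b a≢b ≡ pairIndex c d c≢d → (a ≡ c × b ≡ d) ⊎ (a ≡ d × b ≡ c)
pairIndex-injective {suc r} {a} {b} {c} {d} eq = splitPair-injective a b c d (join-injective eq)
  where
  join-injective : ∀ {s t} → join r (pairs r) s ≡ join r (pairs r) t → s ≡ t
  join-injective {s} {t} eq =
    trans (sym (splitAt-join r (pairs r) s)) (trans (cong (splitAt r) eq) (splitAt-join r (pairs r) t))

  splitPair-injective : ∀ a b c d .{a≢b : a ≢ b} .{c≢d : c ≢ d} →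
    splitPair a b a≢b ≡ splitPair c d c≢d → (a ≡ c × b ≡ d) ⊎ (a ≡ d × b ≡ c)
  splitPair-injective 0F      0F      _       _       {a≢b = a≢b} _    = ⊥-elim-irr (a≢b refl)
  splitPair-injective _       _       0F      0F      {c≢d = c≢d} _    = ⊥-elim-irr (c≢d refl)
  splitPair-injective 0F      (suc b) 0F      (suc d)             refl = inj₁ (refl , refl)
  splitPair-injective 0F      (suc b) (suc c) 0F                  refl = inj₂ (refl , refl)
  splitPair-injective (suc a) 0F      0F      (suc d)             refl = inj₂ (refl , refl)
  splitPair-injective (suc a) 0F      (suc c) 0F                  refl = inj₁ (refl , refl)
  splitPair-injective (suc a) (suc b) (suc c) (suc d)             eq   with pairIndex-injective {a = a} {b} {c} {d} (inj₂-injective eq)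
  ... | inj₁ (refl , refl) = inj₁ (refl , refl)
  ... | inj₂ (refl , refl) = inj₂ (refl , refl)
  splitPair-injective 0F      (suc b) (suc c) (suc d)             ()
  splitPair-injective (suc a) 0F      (suc c) (suc d)             ()
  splitPair-injective (suc a) (suc b) 0F      (suc d)             ()
  splitPair-injective (suc a) (suc b) (suc c) 0F                  ()

pairIndex-↭₂ : {ℓ ℓ′ : Fin 2 → Fin r} .{ℓ≢ : ℓ 0F ≢ ℓ 1F} .{ℓ′≢ : ℓ′ 0F ≢ ℓ′ 1F} →
               ℓ ↭₂ ℓ′ → pairIndex (ℓ 0F) (ℓ 1F) ℓ≢ ≡ pairIndex (ℓ′ 0F) (ℓ′ 1F) ℓ′≢
pairIndex-↭₂ (false , same) = pairIndex-cong (same 0F) (same 1F)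
pairIndex-↭₂ {ℓ = ℓ} {ℓ≢ = ℓ≢} (true , swapped) =
  trans (pairIndex-comm (ℓ 0F) (ℓ 1F) {b≢a = ℓ≢ ∘ sym}) (pairIndex-cong (swapped 0F) (swapped 1F))

pairIndex-↭₂-injective : {ℓ ℓ′ : Fin 2 → Fin r} .{ℓ≢ : ℓ 0F ≢ ℓ 1F} .{ℓ′≢ : ℓ′ 0F ≢ ℓ′ 1F} →
                         pairIndex (ℓ 0F) (ℓ 1F) ℓ≢ ≡ pairIndex (ℓ′ 0F) (ℓ′ 1F) ℓ′≢ → ℓ ↭₂ ℓ′
pairIndex-↭₂-injective {ℓ = ℓ} {ℓ′} eq with pairIndex-injective {a = ℓ 0F} {ℓ 1F} {ℓ′ 0F} {ℓ′ 1F} eq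
... | inj₁ (e₀₀ , e₁₁) = false , λ { 0F → e₀₀ ; 1F → e₁₁ }
... | inj₂ (e₀₁ , e₁₀) = true  , λ { 0F → e₁₀ ; 1F → e₀₁ }

pairOf : Fin (pairs r) → Fin 2 → Fin r
pairOf {suc r} k = [ (λ b → λ { 0F → 0F ; 1F → suc b }) , (λ k′ → suc ∘ pairOf {r} k′) ]′ (splitAt r k)

pairOf-distinct : (k : Fin (pairs r)) → pairOf {r} k 0F ≢ pairOf k 1F
pairOf-distinct {suc r} k with splitAt r k
... | inj₁ b  = λ ()
... | inj₂ k′ = pairOf-distinct {r} k′ ∘ suc-injective

pairIndex-pairOf : (k : Fin (pairs r)) → pairIndex (pairOf {r} k 0F) (pairOf k 1F) (pairOf-distinct {r} k) ≡ k
pairIndex-pairOf {suc r} k with splitAt r k in eq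
... | inj₁ b  = splitAt⁻¹-↑ˡ eq
... | inj₂ k′ = trans (cong (r ↑ʳ_) (pairIndex-pairOf {r} k′)) (splitAt⁻¹-↑ʳ eq)

pairOf-↭₂-injective : {k k′ : Fin (pairs r)} → pairOf {r} k ↭₂ pairOf {r} k′ → k ≡ k′
pairOf-↭₂-injective {r} {k} {k′} k↭k′ =
  trans (sym (pairIndex-pairOf {r} k)) (trans (pairIndex-↭₂ {ℓ = pairOf k} {pairOf k′} k↭k′) (pairIndex-pairOf {r} k′))

module _ {G : Graph} {φ : V (Lex G K2) → Fin r} (distinguishing : Distinguishing (Lex G K2) r φ) where

  lexFlip-rigid : (π : Aut G) (b : V G → Bool) → (∀ v x → φ (π ⟨$⟩ v , flip (b v) x) ≡ φ (v , x)) →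
                  ∀ v → π ⟨$⟩ v ≡ v × b v ≡ false
  lexFlip-rigid π b preserves v = cong proj₁ fixed , flip-0F (cong proj₂ fixed)
    where
    fixed : (π ⟨$⟩ v , flip (b v) 0F) ≡ (v , 0F)
    fixed = distinguishing (lexAut π (flipAut ∘ b)) (λ (w , x) → preserves w x) (v , 0F)

  ↭₂-rigid : (π : Aut G) → (∀ v → curry φ (π ⟨$⟩ v) ↭₂ curry φ v) → ∀ v → π ⟨$⟩ v ≡ v
  ↭₂-rigid π similar = proj₁ ∘ lexFlip-rigid π (proj₁ ∘ similar) (proj₂ ∘ similar)

  twinLabels-distinct : ∀ v → φ (v , 0F) ≢ φ (v , 1F)
  twinLabels-distinct v same = contradiction
    (trans (sym (dec-true (φ (v , 0F) ≟ φ (v , 1F)) same)) (proj₂ (lexFlip-rigid idAut swapIfEqual swapIfEqual-preserves v)))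
    λ ()
    where
    swapIfEqual : V G → Bool
    swapIfEqual w = does (φ (w , 0F) ≟ φ (w , 1F))

    swapIfEqual-preserves : ∀ w x → φ (w , flip (swapIfEqual w) x) ≡ φ (w , x)
    swapIfEqual-preserves w x with φ (w , 0F) ≟ φ (w , 1F) | x
    ... | yes e | 0F = sym e
    ... | yes e | 1F = e
    ... | no _  | _  = refl

MapsFibre : (σ : Aut (Lex G K2)) → V G → V G → Set
MapsFibre σ v w = Σ[ b ∈ Bool ] (∀ x → σ ⟨$⟩ (v , x) ≡ (w , flip b x))

module _ {G : Graph} (σ : Aut (Lex G K2)) where

  twins↦twins : {v w w′ : V G} {c₀ c₁ : Fin 2} → σ ⟨$⟩ (v , 0F) ≡ (w , c₀) → σ ⟨$⟩ (v , 1F) ≡ (w′ , c₁) →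
                ¬ E G w w′ → w ≡ w′ × c₀ ≢ c₁
  twins↦twins e₀ e₁ ¬ww′ with subst₂ (E (Lex G K2)) e₀ e₁ (aut-edge σ (inj₂ (refl , λ ())))
  ... | inj₁ ww′   = ⊥-elim (¬ww′ ww′)
  ... | inj₂ fibre = fibre

  mapsFibre : {v w : V G} {c₀ c₁ : Fin 2} → σ ⟨$⟩ (v , 0F) ≡ (w , c₀) → σ ⟨$⟩ (v , 1F) ≡ (w , c₁) →
              c₀ ≢ c₁ → MapsFibre σ v w
  mapsFibre {c₀ = 0F} {0F} _  _  c₀≢c₁ = ⊥-elim (c₀≢c₁ refl)
  mapsFibre {c₀ = 0F} {1F} e₀ e₁ _     = false , λ { 0F → e₀ ; 1F → e₁ }
  mapsFibre {c₀ = 1F} {0F} e₀ e₁ _     = true  , λ { 0F → e₀ ; 1F → e₁ }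
  mapsFibre {c₀ = 1F} {1F} _  _  c₀≢c₁ = ⊥-elim (c₀≢c₁ refl)

  module _ {φ : V (Lex G K2) → Fin r} (preserves : ∀ p → φ (σ ⟨$⟩ p) ≡ φ p) where

    mapsFibre⇒↭₂ : {v w : V G} → MapsFibre σ v w → curry φ w ↭₂ curry φ v
    mapsFibre⇒↭₂ {v} (b , maps) = b , λ x → trans (cong φ (sym (maps x))) (preserves (v , x))

    mapsFibre-fixes : {v : V G} → φ (v , 0F) ≢ φ (v , 1F) → MapsFibre σ v v → ∀ x → σ ⟨$⟩ (v , x) ≡ (v , x)
    mapsFibre-fixes _        (false , maps) = maps
    mapsFibre-fixes distinct (true  , maps) = ⊥-elim (distinct (sym (proj₂ (mapsFibre⇒↭₂ (true , maps)) 0F)))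

transpose-matchˡ : (i j : Fin n) → transpose i j ⟨$⟩ʳ i ≡ j
transpose-matchˡ i j rewrite dec-true (i ≟ i) refl = refl

transpose-related : (R : Fin n → Fin n → Set) → (∀ {k} → R k k) → {i j : Fin n} → R i j → R j i →
                    ∀ k → R (transpose i j ⟨$⟩ʳ k) k
transpose-related R R-refl {i} {j} Rij Rji k with k ≟ i
... | yes refl = Rji
... | no _ with k ≟ j
...   | yes refl = Rij
...   | no _     = R-refl

spiderMap : (Fin n → Fin n) → SpV n → SpV n
spiderMap f centre   = centre
spiderMap f (mid k)  = mid (f k)
spiderMap f (leaf k) = leaf (f k)

spiderMap-edge : (f : Fin n → Fin n) → PreservesEdges (Spider n) (spiderMap f)
spiderMap-edge f (c-m i) = c-m (f i)
spiderMap-edge f (m-c i) = m-c (f i)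
spiderMap-edge f (m-l i) = m-l (f i)
spiderMap-edge f (l-m i) = l-m (f i)

spiderMap-inverse : {f g : Fin n → Fin n} → (∀ k → f (g k) ≡ k) → ∀ v → spiderMap f (spiderMap g v) ≡ v
spiderMap-inverse f∘g≗id centre   = refl
spiderMap-inverse f∘g≗id (mid k)  = cong mid (f∘g≗id k)
spiderMap-inverse f∘g≗id (leaf k) = cong leaf (f∘g≗id k)

permuteLegs : Permutation′ n → Aut (Spider n)
permuteLegs ρ = mkAut
  (mk↔ₛ′ (spiderMap (ρ ⟨$⟩ʳ_)) (spiderMap (ρ ⟨$⟩ˡ_))
         (spiderMap-inverse (λ _ → inverseʳ ρ)) (spiderMap-inverse (λ _ → inverseˡ ρ)))
  (spiderMap-edge (ρ ⟨$⟩ʳ_)) (spiderMap-edge (ρ ⟨$⟩ˡ_))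

SpiderK2 : ℕ → Graph
SpiderK2 n = Lex (Spider n) K2

mid-injective : {i j : Fin n} → mid i ≡ mid j → i ≡ j
mid-injective refl = refl

module _ {φ : V (SpiderK2 n) → Fin r} (distinguishing : Distinguishing (SpiderK2 n) r φ) where

  legs-distinguished : {i j : Fin n} → curry φ (mid i) ↭₂ curry φ (mid j) → curry φ (leaf i) ↭₂ curry φ (leaf j) →
                       i ≡ j
  legs-distinguished {i} {j} mids↭ leaves↭ =
    trans (sym (mid-injective (↭₂-rigid distinguishing (permuteLegs (transpose i j)) similar (mid i))))
          (transpose-matchˡ i j)
    where
    SimilarLegs : Fin n → Fin n → Set
    SimilarLegs k k′ = curry φ (mid k) ↭₂ curry φ (mid k′) × curry φ (leaf k) ↭₂ curry φ (leaf k′)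

    similarLegs : ∀ k → SimilarLegs (transpose i j ⟨$⟩ʳ k) k
    similarLegs = transpose-related SimilarLegs (↭₂-refl , ↭₂-refl) (mids↭ , leaves↭) (↭₂-sym mids↭ , ↭₂-sym leaves↭)

    similar : ∀ v → curry φ (permuteLegs (transpose i j) ⟨$⟩ v) ↭₂ curry φ v
    similar centre   = ↭₂-refl
    similar (mid k)  = proj₁ (similarLegs k)
    similar (leaf k) = proj₂ (similarLegs k)

lowerBound : HasDistLabeling (SpiderK2 n) r → n ≤ pairs r * pairs r
lowerBound {n} {r} (φ , distinguishing) = injective⇒≤ legType-injective
  where
  labelPair : SpV n → Fin (pairs r)
  labelPair v = pairIndex (φ (v , 0F)) (φ (v , 1F)) (twinLabels-distinct distinguishing v)

  legType : Fin n → Fin (pairs r * pairs r)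
  legType k = combine (labelPair (mid k)) (labelPair (leaf k))

  labelPair-injective : {v w : SpV n} → labelPair v ≡ labelPair w → curry φ v ↭₂ curry φ w
  labelPair-injective {v} {w} = pairIndex-↭₂-injective {ℓ = curry φ v} {curry φ w}

  legType-injective : Injective _≡_ _≡_ legType
  legType-injective eq with combine-injective _ _ _ _ eq
  ... | mids≡ , leaves≡ = legs-distinguished distinguishing (labelPair-injective mids≡) (labelPair-injective leaves≡)

leaf-simplicial : (i : Fin n) (x : Fin 2) → Simplicial (SpiderK2 n) (leaf i , x)
leaf-simplicial i x {mid i , _}  {mid i , _}  (inj₁ (l-m i))  (inj₁ (l-m i))  y≢z = inj₂ (refl , y≢z ∘ cong (mid i ,_))
leaf-simplicial i x {mid i , _}  {leaf i , _} (inj₁ (l-m i))  (inj₂ (refl , _)) _ = inj₁ (m-l i)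
leaf-simplicial i x {leaf i , _} {mid i , _}  (inj₂ (refl , _)) (inj₁ (l-m i))  _ = inj₁ (l-m i)
leaf-simplicial i x {leaf i , _} {leaf i , _} (inj₂ (refl , _)) (inj₂ (refl , _)) y≢z = inj₂ (refl , y≢z ∘ cong (leaf i ,_))

mid-nonsimplicial : {i : Fin n} {x : Fin 2} → ¬ Simplicial (SpiderK2 n) (mid i , x)
mid-nonsimplicial {i = i} simplicial
  with simplicial {centre , 0F} {leaf i , 0F} (inj₁ (m-c i)) (inj₁ (m-l i)) (λ ())
... | inj₁ ()
... | inj₂ (() , _)

centre-nonsimplicial : {x : Fin 2} → ¬ Simplicial (SpiderK2 (2 + n)) (centre , x)
centre-nonsimplicial simplicial
  with simplicial {mid 0F , 0F} {mid 1F , 0F} (inj₁ (c-m 0F)) (inj₁ (c-m 1F)) (λ ())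
... | inj₁ ()
... | inj₂ (() , _)

centre-neighbour-nonsimplicial : {x : Fin 2} {w : V (SpiderK2 (2 + n))} → E (SpiderK2 (2 + n)) (centre , x) w →
                                 ¬ Simplicial (SpiderK2 (2 + n)) w
centre-neighbour-nonsimplicial {w = centre , _} _                  = centre-nonsimplicial
centre-neighbour-nonsimplicial {w = mid _ , _}  _                  = mid-nonsimplicial
centre-neighbour-nonsimplicial {w = leaf _ , _} (inj₁ ())
centre-neighbour-nonsimplicial {w = leaf _ , _} (inj₂ (() , _))

simplicial⇒leaf : {w : V (SpiderK2 (2 + n))} → Simplicial (SpiderK2 (2 + n)) w → ∃₂ λ j c → w ≡ (leaf j , c)
simplicial⇒leaf {w = centre , _} simplicial = ⊥-elim (centre-nonsimplicial simplicial)
simplicial⇒leaf {w = mid _ , _}  simplicial = ⊥-elim (mid-nonsimplicial simplicial)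
simplicial⇒leaf {w = leaf j , c} _          = j , c , refl

mid-leaf-edge : {j k : Fin n} {c d : Fin 2} → E (SpiderK2 n) (mid j , c) (leaf k , d) → j ≡ k
mid-leaf-edge (inj₁ (m-l _))  = refl
mid-leaf-edge (inj₂ (() , _))

module _ (σ : Aut (SpiderK2 (2 + n))) where

  leaf↦leaf : ∀ i x → ∃₂ λ j c → σ ⟨$⟩ (leaf i , x) ≡ (leaf j , c)
  leaf↦leaf i x = simplicial⇒leaf (simplicial-preserve σ (leaf-simplicial i x))

  mid↦mid : ∀ i x → ∃₂ λ j c → σ ⟨$⟩ (mid i , x) ≡ (mid j , c)
  mid↦mid i x with σ ⟨$⟩ (mid i , x) in eq
  ... | mid j , c  = j , c , refl
  ... | leaf j , c = ⊥-elim (mid-nonsimplicial (simplicial-reflect σ (subst (Simplicial _) (sym eq) (leaf-simplicial j c))))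
  ... | centre , c = ⊥-elim (centre-neighbour-nonsimplicial
          (subst (λ w → E (SpiderK2 (2 + n)) w (σ ⟨$⟩ (leaf i , 0F))) eq (aut-edge σ {mid i , x} {leaf i , 0F} (inj₁ (m-l i))))
          (simplicial-preserve σ (leaf-simplicial i 0F)))

centre↦centre : (σ : Aut (SpiderK2 (2 + n))) → ∀ x → ∃ λ c → σ ⟨$⟩ (centre , x) ≡ (centre , c)
centre↦centre σ x with σ ⟨$⟩ (centre , x) in eq
... | centre , c = c , refl
... | leaf j , c = ⊥-elim (centre-nonsimplicial (simplicial-reflect σ (subst (Simplicial _) (sym eq) (leaf-simplicial j c))))
... | mid j , c with mid↦mid (σ ⁻¹) j c
...   | _ , _ , σ⁻¹[mid]≡mid = contradiction
        (trans (sym σ⁻¹[mid]≡mid) (subst (λ w → σ ⁻¹ ⟨$⟩ w ≡ (centre , x)) eq (aut-inverseʳ σ (centre , x))))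
        λ ()

centre-mapsFibre : (σ : Aut (SpiderK2 (2 + n))) → MapsFibre σ centre centre
centre-mapsFibre σ with centre↦centre σ 0F | centre↦centre σ 1F
... | c₀ , e₀ | c₁ , e₁ = mapsFibre σ e₀ e₁ (proj₂ (twins↦twins σ e₀ e₁ λ ()))

leg↦leg : (σ : Aut (SpiderK2 (2 + n))) (i : Fin (2 + n)) → ∃ λ j → MapsFibre σ (mid i) (mid j) × MapsFibre σ (leaf i) (leaf j)
leg↦leg σ i
  with mid↦mid σ i 0F | mid↦mid σ i 1F | leaf↦leaf σ i 0F | leaf↦leaf σ i 1F
... | j , c₀ , e₀ | _ , c₁ , e₁ | k , d₀ , f₀ | _ , d₁ , f₁
  with twins↦twins σ e₀ e₁ (λ ()) | twins↦twins σ f₀ f₁ (λ ())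
     | mid-leaf-edge (subst₂ (E (SpiderK2 _)) e₀ f₀ (aut-edge σ {mid i , 0F} {leaf i , 0F} (inj₁ (m-l i))))
... | refl , c₀≢c₁ | refl , d₀≢d₁ | refl = j , mapsFibre σ e₀ e₁ c₀≢c₁ , mapsFibre σ f₀ f₁ d₀≢d₁

module _ {r : ℕ} where

  legLabeling : (Fin n → Fin (pairs (2 + r)) × Fin (pairs (2 + r))) → V (SpiderK2 n) → Fin (2 + r)
  legLabeling code (centre , x) = x ↑ˡ r
  legLabeling code (mid k , x)  = pairOf {2 + r} (proj₁ (code k)) x
  legLabeling code (leaf k , x) = pairOf {2 + r} (proj₂ (code k)) x

  legLabeling-twinsDistinct : (code : Fin n → Fin (pairs (2 + r)) × Fin (pairs (2 + r))) →
                              ∀ v → legLabeling code (v , 0F) ≢ legLabeling code (v , 1F)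
  legLabeling-twinsDistinct code centre   = λ ()
  legLabeling-twinsDistinct code (mid k)  = pairOf-distinct {2 + r} (proj₁ (code k))
  legLabeling-twinsDistinct code (leaf k) = pairOf-distinct {2 + r} (proj₂ (code k))

  legLabeling-distinguishing : {code : Fin (2 + n) → Fin (pairs (2 + r)) × Fin (pairs (2 + r))} →
                               Injective _≡_ _≡_ code → Distinguishing (SpiderK2 (2 + n)) (2 + r) (legLabeling code)
  legLabeling-distinguishing {code = code} code-injective σ preserves = fixed
    where
    fixes : ∀ {v} → MapsFibre σ v v → ∀ x → σ ⟨$⟩ (v , x) ≡ (v , x)
    fixes {v} = mapsFibre-fixes σ preserves (legLabeling-twinsDistinct code v)

    leg-fixed : ∀ i → MapsFibre σ (mid i) (mid i) × MapsFibre σ (leaf i) (leaf i)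
    leg-fixed i with leg↦leg σ i
    ... | j , mids , leaves
      with code-injective (cong₂ _,_ (pairOf-↭₂-injective {2 + r} (mapsFibre⇒↭₂ σ preserves mids))
                                     (pairOf-↭₂-injective {2 + r} (mapsFibre⇒↭₂ σ preserves leaves)))
    ... | refl = mids , leaves

    fixed : ∀ v → σ ⟨$⟩ v ≡ v
    fixed (centre , x) = fixes (centre-mapsFibre σ) x
    fixed (mid i , x)  = fixes (proj₁ (leg-fixed i)) x
    fixed (leaf i , x) = fixes (proj₂ (leg-fixed i)) x

upperBound : ∀ r → 2 + n ≤ pairs r * pairs r → HasDistLabeling (SpiderK2 (2 + n)) r
upperBound 0 ()
upperBound 1 ()
upperBound {n} (suc (suc r)) 2+n≤pairs² = legLabeling code , legLabeling-distinguishing code-injective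
  where
  code : Fin (2 + n) → Fin (pairs (2 + r)) × Fin (pairs (2 + r))
  code k = Inverse.to *↔× (inject≤ k 2+n≤pairs²)

  code-injective : Injective _≡_ _≡_ code
  code-injective = inject≤-injective _ _ _ _ ∘ Injection.injective (Inverse⇒Injection *↔×)

2*pairs[r]≡r*[r∸1] : ∀ r → 2 * pairs r ≡ r * (r ∸ 1)
2*pairs[r]≡r*[r∸1] 0             = refl
2*pairs[r]≡r*[r∸1] 1             = refl
2*pairs[r]≡r*[r∸1] (suc (suc r)) = begin
  2 * (suc r + pairs (suc r))        ≡⟨ *-distribˡ-+ 2 (suc r) (pairs (suc r)) ⟩
  2 * suc r + 2 * pairs (suc r)      ≡⟨ cong (2 * suc r +_) (2*pairs[r]≡r*[r∸1] (suc r)) ⟩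
  2 * suc r + suc r * r              ≡⟨ next-triangle r ⟩
  suc (suc r) * suc r                ∎
  where
  open ≡-Reasoning
  next-triangle : ∀ r → 2 * suc r + suc r * r ≡ suc (suc r) * suc r
  next-triangle = solve-∀

ceilCond⇔ : ∀ n r → CeilCond n r ⇔ n ≤ pairs r * pairs r
ceilCond⇔ n r = mk⇔ (*-cancelˡ-≤ 4 ∘ subst (4 * n ≤_) square) (subst (4 * n ≤_) (sym square) ∘ *-monoʳ-≤ 4)
  where
  open ≡-Reasoning
  square : r * (r ∸ 1) * (r * (r ∸ 1)) ≡ 4 * (pairs r * pairs r)
  square = begin
    r * (r ∸ 1) * (r * (r ∸ 1))     ≡⟨ cong (λ m → m * m) (2*pairs[r]≡r*[r∸1] r) ⟨
    2 * pairs r * (2 * pairs r)     ≡⟨ double-square (pairs r) ⟩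
    4 * (pairs r * pairs r)         ∎
    where
    double-square : ∀ p → 2 * p * (2 * p) ≡ 4 * (p * p)
    double-square = solve-∀

Least : (ℕ → Set) → ℕ → Set
Least P d = P d × (∀ e → e < d → ¬ P e)

least-cong : {P Q : ℕ → Set} → (∀ r → P r ⇔ Q r) → ∀ {d} → Least P d → Least Q d
least-cong P⇔Q (Pd , minimal) = Equivalence.to (P⇔Q _) Pd , λ e e<d → minimal e e<d ∘ Equivalence.from (P⇔Q e)

lemma2p3 : ∀ n → n ≥ 3 → ∀ d →
    (DistNumberIs (Lex (Spider n) K2) d → IsCeilFormula n d) × (IsCeilFormula n d → DistNumberIs (Lex (Spider n) K2) d)
lemma2p3 (suc (suc (suc n))) (s≤s (s≤s (s≤s _))) d = least-cong distinguishable⇔ceil , least-cong (⇔-sym ∘ distinguishable⇔ceil)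
  where
  distinguishable⇔ceil : ∀ r → HasDistLabeling (SpiderK2 (3 + n)) r ⇔ CeilCond (3 + n) r
  distinguishable⇔ceil r = mk⇔
    (Equivalence.from (ceilCond⇔ (3 + n) r) ∘ lowerBound)
    (upperBound r ∘ Equivalence.to (ceilCond⇔ (3 + n) r))
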